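{- Let $n\ge1$ and $Q_n=\{(\kappa_1,\kappa_2,\kappa_3,\kappa_4)\in\mathbb{Z}_{\ge0}^4:\kappa_3\le1,\ \kappa_1+\kappa_2+\kappa_3+\kappa_4=n,\ \kappa_4\le\kappa_1+\kappa_2\}$. The partitions $(3n-j,j)$ with $0\le j\le\lfloor 3n/2\rfloor$ are in bijection with the integer points of $Q_n$ lying on the line $\kappa_1+\kappa_2=n$ (so $\kappa_3=\kappa_4=0$) or on the line $\kappa_2+\kappa_4=n$ with $\kappa_2\ge\kappa_4$ (so $\kappa_1=\kappa_3=0$).
   Context: In the paper, this bijection sends $(3n-j,j)$ to the final point of the $j$-strand, where the $j$-strand is $\{\kappa\in Q_n:\kappa_2+\kappa_3+2\kappa_4=j\}$ and its final point is its point with largest $\kappa_2$. -}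

module Defs where

open import Data.Nat using (ℕ; _+_; _*_; _≤_)
open import Data.Nat.DivMod using (_/_)
open import Data.Product using (_×_; _,_; Σ; ∃)
open import Data.Sum using (_⊎_)
open import Relation.Binary.PropositionalEquality using (_≡_)

record Pt : Set where
  constructor pt
  field
    κ₁ κ₂ κ₃ κ₄ : ℕ
open Pt public

InQ : ℕ → Pt → Set
InQ n κ = (κ₃ κ ≤ 1) × (κ₁ κ + κ₂ κ + κ₃ κ + κ₄ κ ≡ n) × (κ₄ κ ≤ κ₁ κ + κ₂ κ)

InStrand : ℕ → Pt → Set
InStrand j κ = κ₂ κ + κ₃ κ + 2 * κ₄ κ ≡ j

IsFinalPoint : ℕ → ℕ → Pt → Set
IsFinalPoint n j κ =
  InQ n κ × InStrand j κ × (∀ κ' → InQ n κ' → InStrand j κ' → κ₂ κ' ≤ κ₂ κ)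

OnLines : ℕ → Pt → Set
OnLines n κ = (κ₁ κ + κ₂ κ ≡ n) ⊎ ((κ₂ κ + κ₄ κ ≡ n) × (κ₄ κ ≤ κ₂ κ))

maxJ : ℕ → ℕ
maxJ n = (3 * n) / 2

{-# OPTIONS --safe #-}
-- On the j-strand κ₂ ≤ j, and 2n = 2(κ₁+κ₂+κ₃+κ₄) ≥ κ₂ + j, so the final point has
-- κ₂ ≤ min(j, 2n − j). For j ≤ n the point (n − j, j, 0, 0) of the first line attains
-- κ₂ = j; for n < j ≤ ⌊3n/2⌋ the point (0, 2n − j, 0, j − n) of the second line attains
-- κ₂ = 2n − j. Conversely every point of Q_n on either line is of one of these shapes,
-- and the strand index j is read off the point, which gives injectivity.
module Submission where

open import Defs
open import Data.Nat using (ℕ; zero; suc; _+_; _*_; _∸_; _≤_; _≤?_; z≤n; NonZero)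
open import Data.Nat.Properties
open import Data.Nat.DivMod using (_/_; m*n/n≡m; m/n*n≤m; /-monoˡ-≤)
open import Data.Nat.Tactic.RingSolver using (solve-∀)
open import Data.Product using (_×_; _,_; proj₁; proj₂; Σ-syntax; ∃-syntax)
open import Data.Sum using (inj₁; inj₂)
open import Relation.Nullary using (yes; no)
open import Relation.Nullary.Negation using (contradiction)
open import Relation.Binary.PropositionalEquality

m*n≤o⇒m≤o/n : ∀ m n {o} .{{_ : NonZero n}} → m * n ≤ o → m ≤ o / n
m*n≤o⇒m≤o/n m n le = subst (_≤ _) (m*n/n≡m m n) (/-monoˡ-≤ n le)

m≤o/n⇒m*n≤o : ∀ m n {o} .{{_ : NonZero n}} → m ≤ o / n → m * n ≤ o
m≤o/n⇒m*n≤o m n {o} le = ≤-trans (*-monoˡ-≤ n le) (m/n*n≤m o n)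

2j≤3n⇒j≤maxJ : ∀ {n} j → 2 * j ≤ 3 * n → j ≤ maxJ n
2j≤3n⇒j≤maxJ {n} j le = m*n≤o⇒m≤o/n j 2 (subst (_≤ 3 * n) (*-comm 2 j) le)

j≤maxJ⇒2j≤3n : ∀ {n} j → j ≤ maxJ n → 2 * j ≤ 3 * n
j≤maxJ⇒2j≤3n {n} j le = subst (_≤ 3 * n) (*-comm j 2) (m≤o/n⇒m*n≤o j 2 le)

strand : Pt → ℕ
strand κ = κ₂ κ + κ₃ κ + 2 * κ₄ κ

κ₂≤strand : ∀ κ → κ₂ κ ≤ strand κ
κ₂≤strand (pt _ b c d) = ≤-trans (m≤m+n b c) (m≤m+n (b + c) (2 * d))

κ₂+strand≤2*size : ∀ κ → κ₂ κ + strand κ ≤ 2 * (κ₁ κ + κ₂ κ + κ₃ κ + κ₄ κ)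
κ₂+strand≤2*size (pt a b c d) =
  subst (b + (b + c + 2 * d) ≤_) (sym (doubled a b c d)) (m≤m+n _ (2 * a + c))
  where
  doubled : ∀ a b c d → 2 * (a + b + c + d) ≡ b + (b + c + 2 * d) + (2 * a + c)
  doubled = solve-∀

data LinePoint : ℕ → ℕ → Set where
  lower : ∀ a b → LinePoint (a + b) b
  upper : ∀ b d → d ≤ b → LinePoint (b + d) (b + 2 * d)

point : ∀ {n j} → LinePoint n j → Pt
point (lower a b)   = pt a b 0 0
point (upper b d _) = pt 0 b 0 d

point-onLines : ∀ {n j} (v : LinePoint n j) → OnLines n (point v)
point-onLines (lower a b)     = inj₁ refl
point-onLines (upper b d d≤b) = inj₂ (refl , d≤b)

point-isFinalPoint : ∀ {n j} (v : LinePoint n j) → IsFinalPoint n j (point v)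
point-isFinalPoint (lower a b) =
  (z≤n , trans (+-identityʳ (a + b + 0)) (+-identityʳ (a + b)) , z≤n)
  , trans (+-identityʳ (b + 0)) (+-identityʳ b)
  , λ κ _ κ∈strand → subst (κ₂ κ ≤_) κ∈strand (κ₂≤strand κ)
point-isFinalPoint (upper b d d≤b) =
  (z≤n , cong (_+ d) (+-identityʳ b) , d≤b)
  , cong (_+ 2 * d) (+-identityʳ b)
  , maximal
  where
  maximal : ∀ κ → InQ (b + d) κ → InStrand (b + 2 * d) κ → κ₂ κ ≤ b
  maximal κ (_ , size , _) κ∈strand = +-cancelʳ-≤ (b + 2 * d) (κ₂ κ) b (begin
    κ₂ κ + (b + 2 * d) ≡⟨ cong (κ₂ κ +_) κ∈strand ⟨
    κ₂ κ + strand κ  ≤⟨ κ₂+strand≤2*size κ ⟩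
    2 * (κ₁ κ + κ₂ κ + κ₃ κ + κ₄ κ) ≡⟨ cong (2 *_) size ⟩
    2 * (b + d)      ≡⟨ doubled b d ⟩
    b + (b + 2 * d)  ∎)
    where
    open ≤-Reasoning
    doubled : ∀ b d → 2 * (b + d) ≡ b + (b + 2 * d)
    doubled = solve-∀

linePoint-bound : ∀ {n j} → LinePoint n j → j ≤ maxJ n
linePoint-bound (lower a b)     = 2j≤3n⇒j≤maxJ {a + b} b
  (≤-trans (*-monoˡ-≤ b (n≤1+n 2)) (*-monoʳ-≤ 3 (m≤n+m b a)))
linePoint-bound (upper b d d≤b) = 2j≤3n⇒j≤maxJ {b + d} (b + 2 * d)
  (subst₂ _≤_ (sym (twice b d)) (sym (thrice b d)) (+-monoʳ-≤ (2 * b + 3 * d) d≤b))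
  where
  twice : ∀ b d → 2 * (b + 2 * d) ≡ 2 * b + 3 * d + d
  twice = solve-∀
  thrice : ∀ b d → 3 * (b + d) ≡ 2 * b + 3 * d + b
  thrice = solve-∀

2[n+k]≤3n⇒2k≤n : ∀ n k → 2 * (n + k) ≤ 3 * n → 2 * k ≤ n
2[n+k]≤3n⇒2k≤n n k le =
  +-cancelˡ-≤ (2 * n) (2 * k) n (subst₂ _≤_ (*-distribˡ-+ 2 n k) (thrice n) le)
  where
  thrice : ∀ n → 3 * n ≡ 2 * n + n
  thrice = solve-∀

linePoint : ∀ n j → j ≤ maxJ n → LinePoint n j
linePoint n j j≤maxJ with j ≤? n
... | yes j≤n with m≤n⇒∃[o]m+o≡n j≤n
...   | a , refl = subst (λ m → LinePoint m j) (+-comm a j) (lower a j)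
linePoint n j j≤maxJ | no j≰n with m≤n⇒∃[o]m+o≡n (≰⇒≥ j≰n)
... | k , refl with m≤n⇒∃[o]m+o≡n (2[n+k]≤3n⇒2k≤n n k (j≤maxJ⇒2j≤3n {n} (n + k) j≤maxJ))
...   | m , refl = subst₂ LinePoint (size k m) (index k m) (upper (k + m) k (m≤m+n k m))
  where
  size : ∀ k m → k + m + k ≡ 2 * k + m
  size = solve-∀
  index : ∀ k m → k + m + 2 * k ≡ 2 * k + m + k
  index = solve-∀

m+2n∸[m+n]≡n : ∀ m n → m + 2 * n ∸ (m + n) ≡ n
m+2n∸[m+n]≡n m n = trans (cong (_∸ (m + n)) (regroup m n)) (m+n∸m≡n (m + n) n)
  where
  regroup : ∀ m n → m + 2 * n ≡ m + n + n
  regroup = solve-∀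

finalPoint : ℕ → ℕ → Pt
finalPoint n j with j ≤? n
... | yes _ = pt (n ∸ j) j 0 0
... | no _  = pt 0 (n ∸ (j ∸ n)) 0 (j ∸ n)

finalPoint≡point : ∀ {n j} (v : LinePoint n j) → finalPoint n j ≡ point v
finalPoint≡point (lower a b) with b ≤? a + b
... | yes _   = cong (λ x → pt x b 0 0) (m+n∸n≡m a b)
... | no b≰n  = contradiction (m≤n+m b a) b≰n
finalPoint≡point (upper b zero _) rewrite +-identityʳ b = finalPoint≡point (lower 0 b)
finalPoint≡point (upper b d@(suc e) _) with b + 2 * d ≤? b + d
... | yes le = contradiction (+-cancelˡ-≤ b _ _ le) (m+1+n≰m d)
... | no _ rewrite m+2n∸[m+n]≡n b d = cong (λ x → pt 0 x 0 d) (m+n∸n≡m b d)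

interchange : ∀ a b c d → a + c + (b + d) ≡ a + b + c + d
interchange = solve-∀

onLines⇒linePoint : ∀ {n} κ → InQ n κ → OnLines n κ →
                    Σ[ j ∈ ℕ ] Σ[ v ∈ LinePoint n j ] point v ≡ κ
onLines⇒linePoint (pt a b c d) (_ , size , _) (inj₁ refl)
  with +-cancelˡ-≡ (a + b) (c + d) 0
         (trans (sym (+-assoc (a + b) c d)) (trans size (sym (+-identityʳ (a + b)))))
... | c+d≡0 with m+n≡0⇒m≡0 c c+d≡0 | m+n≡0⇒n≡0 c c+d≡0
...   | refl | refl = b , lower a b , refl
onLines⇒linePoint (pt a b c d) (_ , size , _) (inj₂ (refl , d≤b))
  with +-cancelʳ-≡ (b + d) (a + c) 0 (trans (interchange a b c d) size)
... | a+c≡0 with m+n≡0⇒m≡0 a a+c≡0 | m+n≡0⇒n≡0 a a+c≡0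
...   | refl | refl = b + 2 * d , upper b d d≤b , refl

mainTheorem13 : (n : ℕ) → 1 ≤ n →
    Σ[ f ∈ (ℕ → Pt) ]
      -- f j is the final point of the j-strand, and it lies on the two lines
      ((∀ j → j ≤ maxJ n → IsFinalPoint n j (f j) × OnLines n (f j))
      -- injective on {0,…,⌊3n/2⌋}
      × (∀ j j' → j ≤ maxJ n → j' ≤ maxJ n → f j ≡ f j' → j ≡ j')
      -- surjective onto the points of Q_n on the two lines
      × (∀ κ → InQ n κ → OnLines n κ → ∃[ j ] (j ≤ maxJ n × f j ≡ κ)))
mainTheorem13 n _ = finalPoint n , final , injective , surjective
  where
  final : ∀ j → j ≤ maxJ n → IsFinalPoint n j (finalPoint n j) × OnLines n (finalPoint n j)
  final j j≤maxJ rewrite finalPoint≡point (linePoint n j j≤maxJ) =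
    point-isFinalPoint (linePoint n j j≤maxJ) , point-onLines (linePoint n j j≤maxJ)

  strand-finalPoint : ∀ j → j ≤ maxJ n → strand (finalPoint n j) ≡ j
  strand-finalPoint j j≤maxJ = proj₁ (proj₂ (proj₁ (final j j≤maxJ)))

  injective : ∀ j j' → j ≤ maxJ n → j' ≤ maxJ n → finalPoint n j ≡ finalPoint n j' → j ≡ j'
  injective j j' j≤maxJ j'≤maxJ eq =
    trans (sym (strand-finalPoint j j≤maxJ)) (trans (cong strand eq) (strand-finalPoint j' j'≤maxJ))

  surjective : ∀ κ → InQ n κ → OnLines n κ → ∃[ j ] (j ≤ maxJ n × finalPoint n j ≡ κ)
  surjective κ κ∈Q κ∈lines with onLines⇒linePoint κ κ∈Q κ∈lines
  ... | j , v , refl = j , linePoint-bound v , finalPoint≡point v
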